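{- Let $L$ be a lattice with $\mathbb{Z}$-basis $\beta_1,\dots,\beta_\ell$, $\Gamma$ a finite group, $\rho:\Gamma\to\mathrm{GL}(L)$ injective, and $\gamma\in\Gamma$. Let $r=r(\gamma)=\mathrm{rank}(R_\gamma-I)$, let $d_{\gamma,1}\mid\cdots\mid d_{\gamma,r}$ be the elementary divisors of $R_\gamma-I$, and let $U=(u_{ij})$, $V$ be unimodular with $U(R_\gamma-I)V=\mathrm{diag}(d_{\gamma,1},\dots,d_{\gamma,r},0,\dots,0)$; put $u_i=u_{i1}\beta_1+\dots+u_{i\ell}\beta_\ell$. Then $$T^\gamma=\Big\{\sum_{i\le r}\pi_T(a_id_{\gamma,i}^{ -1}u_i)+\sum_{i>r}\pi_T(b_iu_i):a_i\in\mathbb{Z},\ b_i\in\mathbb{R}\Big\},$$ and for $q\in\mathbb{Z}_{>0}$, $$T[q]^\gamma=\Big\{\sum_{i\le r}\pi_T\big(a_ig_{\gamma,i}(q)^{ -1}u_i\big)+\sum_{i>r}\pi_T(b_iq^{ -1}u_i):a_i,b_i\in\mathbb{Z}\Big\},$$ where $g_{\gamma,i}(q)=\gcd\{d_{\gamma,i},q\}$.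
   Context: $L_{\mathbb{R}}=L\otimes\mathbb{R}$; $x=\sum x_i\beta_i$ is identified with $(x_1,\dots,x_\ell)$ and $R_\gamma$ is the integer matrix with $\rho(\gamma)(x)=xR_\gamma$. $T=L_{\mathbb{R}}/L$, $\pi_T$ the projection, $\rho_T(\gamma)\circ\pi_T=\pi_T\circ\rho(\gamma)$. $T^\gamma$ is the fixed-point set of $\rho_T(\gamma)$, $T[q]=\{t:qt=0\}$, $T[q]^\gamma=T[q]\cap T^\gamma$. -}

module Defs where

open import Level using (0ℓ)
open import Data.Nat as ℕ using (ℕ; zero; suc)
open import Data.Nat.GCD using (gcd)
open import Data.Nat.Divisibility using (_∣_)
open import Data.Integer as ℤ using (ℤ; +_; -[1+_])
open import Data.Fin using (Fin; zero; suc; toℕ; fromℕ<)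
open import Data.Product using (Σ; ∃; _×_; _,_)
open import Data.Sum using (_⊎_)
open import Relation.Binary.PropositionalEquality using (_≡_)
open import Relation.Binary.Structures using (IsStrictTotalOrder)
open import Relation.Nullary using (¬_; yes; no)
open import Algebra.Structures using (IsCommutativeRing)
open import Algebra.Bundles using (Group)
open import Function.Bundles using (Surjection)

∑ : {A : Set} → (A → A → A) → A → {n : ℕ} → (Fin n → A) → A
∑ _⊕_ e {zero}  f = e
∑ _⊕_ e {suc n} f = f zero ⊕ ∑ _⊕_ e (λ i → f (suc i))

Mat : ℕ → Set
Mat ℓ = Fin ℓ → Fin ℓ → ℤ

module _ {ℓ : ℕ} where

  _≋_ : Mat ℓ → Mat ℓ → Set
  A ≋ B = ∀ i j → A i j ≡ B i j

  _⊗_ : Mat ℓ → Mat ℓ → Mat ℓ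
  (A ⊗ B) i j = ∑ ℤ._+_ (+ 0) (λ k → A i k ℤ.* B k j)

  I : Mat ℓ
  I i j with toℕ i ℕ.≟ toℕ j
  ... | yes _ = + 1
  ... | no  _ = + 0

  _⊖_ : Mat ℓ → Mat ℓ → Mat ℓ
  (A ⊖ B) i j = A i j ℤ.- B i j

  Unimodular : Mat ℓ → Set
  Unimodular A = Σ (Mat ℓ) λ B → ((A ⊗ B) ≋ I) × ((B ⊗ A) ≋ I)

  diag : (r : ℕ) → (Fin r → ℕ) → Mat ℓ
  diag r d i j with toℕ i ℕ.≟ toℕ j | toℕ i ℕ.<? r
  ... | yes _ | yes i<r = + (d (fromℕ< i<r))
  ... | yes _ | no  _   = + 0
  ... | no  _ | _       = + 0

  -- d₁ ∣ d₂ ∣ ⋯ ∣ d_r, all positive, and U (R - I) V = diag(d,0):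
  -- (r, d) are the rank and elementary divisors of R - I, (U, V) a
  -- Smith-normal-form transformation.
  IsSmithForm : Mat ℓ → (r : ℕ) → (Fin r → ℕ) → Mat ℓ → Mat ℓ → Set
  IsSmithForm R r d U V =
    (r ℕ.≤ ℓ) ×
    (∀ i → 0 ℕ.< d i) ×
    (∀ (i j : Fin r) → suc (toℕ i) ≡ toℕ j → d i ∣ d j) ×
    Unimodular U × Unimodular V ×
    ((U ⊗ (R ⊖ I)) ⊗ V) ≋ diag r d

-- Finite group Γ with an injective representation ρ : Γ → GL(L), L ≅ ℤ^ℓ
-- via the basis β; ρ(γ)(x) = x R_γ (row vectors), so R_{gh} = R_h R_g.

record FaithfulRep (Γ : Group 0ℓ 0ℓ) (ℓ : ℕ) : Set where
  open Group Γ
  field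
    R          : Carrier → Mat ℓ
    R-cong     : ∀ {g h} → g ≈ h → R g ≋ R h
    R-hom      : ∀ g h → R (g ∙ h) ≋ (R h ⊗ R g)
    R-ε        : R ε ≋ I
    R-injective : ∀ g h → R g ≋ R h → g ≈ h

Finite : Group 0ℓ 0ℓ → Set
Finite Γ = ∃ λ n → Surjection (≡-setoid (Fin n)) (Group.setoid Γ)
  where open import Relation.Binary.PropositionalEquality using () renaming (setoid to ≡-setoid)

-- The real numbers, given axiomatically as a Dedekind-complete ordered
-- field; the theorem is stated for every model of these axioms.

record Reals : Set₁ where
  infixl 6 _+_
  infixl 7 _*_
  infix 4 _<_
  field
    ℝ      : Set
    0ℝ 1ℝ  : ℝ
    _+_ _*_ : ℝ → ℝ → ℝ
    -_     : ℝ → ℝ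
    _⁻¹    : ℝ → ℝ
    _<_    : ℝ → ℝ → Set
    isCommutativeRing : IsCommutativeRing _≡_ _+_ _*_ -_ 0ℝ 1ℝ
    0≢1    : ¬ (0ℝ ≡ 1ℝ)
    inverse : ∀ x → ¬ (x ≡ 0ℝ) → x * (x ⁻¹) ≡ 1ℝ
    isStrictTotalOrder : IsStrictTotalOrder _≡_ _<_
    +-mono-< : ∀ x y z → x < y → x + z < y + z
    *-pos   : ∀ x y → 0ℝ < x → 0ℝ < y → 0ℝ < x * y
    complete : (S : ℝ → Set) → (∃ λ x → S x) →
               (∃ λ b → ∀ x → S x → (x < b) ⊎ (x ≡ b)) →
               ∃ λ s → (∀ x → S x → (x < s) ⊎ (x ≡ s)) ×
                       (∀ b → (∀ x → S x → (x < b) ⊎ (x ≡ b)) → (s < b) ⊎ (s ≡ b))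

module Torus (ℝs : Reals) {ℓ : ℕ} where
  open Reals ℝs

  ιℕ : ℕ → ℝ
  ιℕ zero    = 0ℝ
  ιℕ (suc n) = 1ℝ + ιℕ n

  ι : ℤ → ℝ
  ι (+ n)    = ιℕ n
  ι -[1+ n ] = - ιℕ (suc n)

  -- L_ℝ ≅ ℝ^ℓ via coordinates w.r.t. β
  Vecℝ : Set
  Vecℝ = Fin ℓ → ℝ

  -- π_T x ≡ π_T y  in  T = L_ℝ / L   (x - y ∈ L)
  _∼_ : Vecℝ → Vecℝ → Set
  x ∼ y = ∃ λ (z : Fin ℓ → ℤ) → ∀ j → x j ≡ y j + ι (z j)

  act : Mat ℓ → Vecℝ → Vecℝ
  act M x j = ∑ _+_ 0ℝ (λ i → x i * ι (M i j))

  InTγ : Mat ℓ → Vecℝ → Set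
  InTγ M x = act M x ∼ x

  InTq : ℕ → Vecℝ → Set
  InTq q x = (λ j → ι (+ q) * x j) ∼ (λ _ → 0ℝ)

  -- ∑_i c_i u_i, with u_i = ∑_j U i j β_j
  comb : Mat ℓ → Vecℝ → Vecℝ
  comb U c j = ∑ _+_ 0ℝ (λ i → c i * ι (U i j))

  split : (r : ℕ) → ((i : Fin r) → ℝ) → (Fin ℓ → ℝ) → Fin ℓ → ℝ
  split r f g i with toℕ i ℕ.<? r
  ... | yes i<r = f (fromℕ< i<r)
  ... | no  _   = g i

  InRHS₁ : Mat ℓ → (r : ℕ) → (Fin r → ℕ) → Vecℝ → Set
  InRHS₁ U r d x =
    ∃ λ (a : Fin r → ℤ) → ∃ λ (b : Fin ℓ → ℝ) →
      x ∼ comb U (split r (λ i → ι (a i) * (ι (+ d i)) ⁻¹) b)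

  InRHS₂ : Mat ℓ → (r : ℕ) → (Fin r → ℕ) → ℕ → Vecℝ → Set
  InRHS₂ U r d q x =
    ∃ λ (a : Fin r → ℤ) → ∃ λ (b : Fin ℓ → ℤ) →
      x ∼ comb U (split r (λ i → ι (a i) * (ι (+ gcd (d i) q)) ⁻¹)
                          (λ i → ι (b i) * (ι (+ q)) ⁻¹))

-- Write x = ∑ cᵢ uᵢ, i.e. c = x U⁻¹. Since U and V are unimodular, x (R − I) is integral iff
-- c U (R − I) V = c diag(d, 0) is, i.e. iff cᵢ dᵢ ∈ ℤ for i ≤ r; likewise q x is integral iff q c is.
-- Both conditions depend only on the class of x in T, and by Bézout "cᵢ dᵢ ∈ ℤ and q cᵢ ∈ ℤ" is
-- equivalent to cᵢ gcd(dᵢ, q) ∈ ℤ. Solving these conditions for c gives the two parametrisations.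
module Submission where

open import Defs
open import Level using (0ℓ)
open import Data.Nat as ℕ using (ℕ; zero; suc; _<_)
open import Data.Nat.Divisibility using (_∣_; divides)
open import Data.Nat.GCD using (gcd; module Bézout; gcd-GCD; gcd[m,n]∣m; gcd[m,n]∣n; gcd[m,n]≢0)
open import Data.Integer as ℤ using (ℤ; -[1+_])
import Data.Integer.Properties as ℤ
open import Data.Fin using (Fin; zero; suc; toℕ; fromℕ<; inject≤)
import Data.Fin.Properties as Finₚ
import Data.Nat.Properties as ℕₚ
open import Function.Base using (_∘_)
open import Data.Product using (∃; _×_; _,_; proj₁; proj₂)
open import Data.Sum using (inj₂)
open import Function.Bundles using (_⇔_; mk⇔; Equivalence)
open import Data.Empty using (⊥-elim)
open import Relation.Nullary using (¬_; yes; no)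
open import Relation.Binary.PropositionalEquality
open import Relation.Binary.Definitions using (tri<; tri≈; tri>)
open import Relation.Binary.Structures using (IsStrictTotalOrder)
open import Algebra.Bundles using (CommutativeRing; Group)
import Algebra.Properties.Ring as RingProperties
import Relation.Binary.Reasoning.Setoid as SetoidReasoning
open import Function.Properties.Equivalence using (⇔-setoid)
import Algebra.Properties.Semiring.Mult as SemiringMult
import Algebra.Properties.CommutativeSemigroup as CommutativeSemigroupProperties

-- ℓ is only there because ι and ιℕ are defined inside Torus, which is indexed by the dimension.
module Scalars (ℝs : Reals) {ℓ : ℕ} where
  open Reals ℝs using (ℝ; _⁻¹; inverse; 0≢1; isStrictTotalOrder; +-mono-<; *-pos) renaming (_<_ to _<ℝ_)
  open Torus ℝs {ℓ} using (ιℕ; ι)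

  ℝ-commutativeRing : CommutativeRing 0ℓ 0ℓ
  ℝ-commutativeRing = record { isCommutativeRing = Reals.isCommutativeRing ℝs }

  open CommutativeRing ℝ-commutativeRing public
    using (_+_; _*_; -_; 0#; 1#; +-identityˡ; +-identityʳ; *-identityˡ; *-identityʳ;
           +-comm; *-comm; +-assoc; *-assoc; zeroʳ; distribˡ; distribʳ; -‿inverseˡ; -‿inverseʳ)
  open CommutativeRing ℝ-commutativeRing using (ring; semiring; +-commutativeSemigroup; *-commutativeSemigroup)
  module +-CS = CommutativeSemigroupProperties +-commutativeSemigroup
  module *-CS = CommutativeSemigroupProperties *-commutativeSemigroup
  open RingProperties ring public
    using (-0#≈0#; -‿involutive; -‿distribˡ-*; -‿distribʳ-*; x≈z//y; xyx⁻¹≈y; -‿+-comm;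
           x[y-z]≈xy-xz; -1*x≈-x)
  open SemiringMult semiring using (×-homo-+; ×1-homo-*) renaming (_×_ to _×ℝ_)

  infixl 6 _-_
  _-_ : ℝ → ℝ → ℝ
  x - y = x + - y

  x≡y+z⇒x-y≡z : ∀ {x y z} → x ≡ y + z → x - y ≡ z
  x≡y+z⇒x-y≡z {y = y} {z} refl = xyx⁻¹≈y y z

  x-y≡z⇒x≡y+z : ∀ {x y z} → x - y ≡ z → x ≡ y + z
  x-y≡z⇒x≡y+z {x} {y} {z} eq = begin
    x             ≡⟨ x≈z//y x (- y) z eq ⟩
    z - - y       ≡⟨ cong (z +_) (-‿involutive y) ⟩
    z + y         ≡⟨ +-comm z y ⟩
    y + z         ∎
    where open ≡-Reasoning

  ιℕ≡×1 : ∀ n → ιℕ n ≡ n ×ℝ 1#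
  ιℕ≡×1 zero    = refl
  ιℕ≡×1 (suc n) = cong (1# +_) (ιℕ≡×1 n)

  ιℕ-+ : ∀ m n → ιℕ (m ℕ.+ n) ≡ ιℕ m + ιℕ n
  ιℕ-+ m n rewrite ιℕ≡×1 (m ℕ.+ n) | ιℕ≡×1 m | ιℕ≡×1 n = ×-homo-+ 1# m n

  ιℕ-* : ∀ m n → ιℕ (m ℕ.* n) ≡ ιℕ m * ιℕ n
  ιℕ-* m n rewrite ιℕ≡×1 (m ℕ.* n) | ιℕ≡×1 m | ιℕ≡×1 n = ×1-homo-* m n

  ι-⊖ : ∀ m n → ι (m ℤ.⊖ n) + ιℕ n ≡ ιℕ m
  ι-⊖ zero    zero    = +-identityˡ 0#
  ι-⊖ zero    (suc n) = -‿inverseˡ (ιℕ (suc n))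
  ι-⊖ (suc m) zero    = +-identityʳ (ιℕ (suc m))
  ι-⊖ (suc m) (suc n) = begin
    ι (suc m ℤ.⊖ suc n) + (1# + ιℕ n)  ≡⟨ cong (λ k → ι k + (1# + ιℕ n)) (ℤ.[1+m]⊖[1+n]≡m⊖n m n) ⟩
    ι (m ℤ.⊖ n) + (1# + ιℕ n)          ≡⟨ +-CS.x∙yz≈y∙xz (ι (m ℤ.⊖ n)) 1# (ιℕ n) ⟩
    1# + (ι (m ℤ.⊖ n) + ιℕ n)          ≡⟨ cong (1# +_) (ι-⊖ m n) ⟩
    1# + ιℕ m                          ∎
    where open ≡-Reasoning

  ι-+ : ∀ i j → ι (i ℤ.+ j) ≡ ι i + ι j
  ι-+ (ℤ.+ m)  (ℤ.+ n)  = ιℕ-+ m n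
  ι-+ (ℤ.+ m)  -[1+ n ] = x≈z//y _ _ _ (ι-⊖ m (suc n))
  ι-+ -[1+ m ] (ℤ.+ n)  = trans (x≈z//y _ _ _ (ι-⊖ n (suc m))) (+-comm _ _)
  ι-+ -[1+ m ] -[1+ n ] = begin
    - (1# + (1# + ιℕ (m ℕ.+ n)))       ≡⟨ cong (λ t → - (1# + (1# + t))) (ιℕ-+ m n) ⟩
    - (1# + (1# + (ιℕ m + ιℕ n)))      ≡⟨ cong -_ (regroup 1# (ιℕ m) (ιℕ n)) ⟩
    - ((1# + ιℕ m) + (1# + ιℕ n))      ≡⟨ -‿+-comm (1# + ιℕ m) (1# + ιℕ n) ⟨
    - (1# + ιℕ m) + - (1# + ιℕ n)      ∎
    where
    open ≡-Reasoning
    regroup : ∀ u a b → u + (u + (a + b)) ≡ (u + a) + (u + b)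
    regroup u a b = trans (cong (u +_) (sym (+-assoc u a b))) (+-CS.x∙yz≈y∙xz u (u + a) b)

  ι-neg : ∀ i → ι (ℤ.- i) ≡ - ι i
  ι-neg -[1+ n ]      = sym (-‿involutive _)
  ι-neg (ℤ.+ zero)    = sym -0#≈0#
  ι-neg (ℤ.+ (suc n)) = refl

  ι-+* : ∀ m j → ι (ℤ.+ m ℤ.* j) ≡ ιℕ m * ι j
  ι-+* m (ℤ.+ n)  = trans (cong ι (sym (ℤ.pos-* m n))) (ιℕ-* m n)
  ι-+* m -[1+ n ] = begin
    ι (ℤ.+ m ℤ.* -[1+ n ])              ≡⟨ cong ι (ℤ.neg-distribʳ-* (ℤ.+ m) (ℤ.+ suc n)) ⟨
    ι (ℤ.- (ℤ.+ m ℤ.* ℤ.+ suc n))       ≡⟨ ι-neg (ℤ.+ m ℤ.* ℤ.+ suc n) ⟩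
    - ι (ℤ.+ m ℤ.* ℤ.+ suc n)           ≡⟨ cong -_ (ι-+* m (ℤ.+ suc n)) ⟩
    - (ιℕ m * ιℕ (suc n))               ≡⟨ -‿distribʳ-* (ιℕ m) (ιℕ (suc n)) ⟩
    ιℕ m * - ιℕ (suc n)                 ∎
    where open ≡-Reasoning

  ι-* : ∀ i j → ι (i ℤ.* j) ≡ ι i * ι j
  ι-* (ℤ.+ m)  j = ι-+* m j
  ι-* -[1+ m ] j = begin
    ι (-[1+ m ] ℤ.* j)                  ≡⟨ cong ι (ℤ.neg-distribˡ-* (ℤ.+ suc m) j) ⟨
    ι (ℤ.- (ℤ.+ suc m ℤ.* j))           ≡⟨ ι-neg (ℤ.+ suc m ℤ.* j) ⟩
    - ι (ℤ.+ suc m ℤ.* j)               ≡⟨ cong -_ (ι-+* (suc m) j) ⟩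
    - (ιℕ (suc m) * ι j)                ≡⟨ -‿distribˡ-* (ιℕ (suc m)) (ι j) ⟩
    - ιℕ (suc m) * ι j                  ∎
    where open ≡-Reasoning

  ι-∑ : ∀ {n} (f : Fin n → ℤ) → ι (∑ ℤ._+_ (ℤ.+ 0) f) ≡ ∑ _+_ 0# (λ i → ι (f i))
  ι-∑ {zero}  f = refl
  ι-∑ {suc n} f = trans (ι-+ (f zero) _) (cong (ι (f zero) +_) (ι-∑ (λ i → f (suc i))))

  private module <-STO = IsStrictTotalOrder isStrictTotalOrder

  -1*-1≡1 : - 1# * - 1# ≡ 1#
  -1*-1≡1 = begin
    - 1# * - 1#        ≡⟨ -‿distribˡ-* 1# (- 1#) ⟨
    - (1# * - 1#)      ≡⟨ cong -_ (*-identityˡ (- 1#)) ⟩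
    - - 1#             ≡⟨ -‿involutive 1# ⟩
    1#                 ∎
    where open ≡-Reasoning

  0<1 : 0# <ℝ 1#
  0<1 with <-STO.compare 0# 1#
  ... | tri< 0<1 _ _ = 0<1
  ... | tri≈ _ 0≡1 _ = ⊥-elim (0≢1 0≡1)
  ... | tri> _ _ 1<0 = ⊥-elim (<-STO.irrefl refl (<-STO.trans 1<0 0<[-1]*[-1]))
    where
    0<-1 : 0# <ℝ - 1#
    0<-1 = subst₂ _<ℝ_ (-‿inverseʳ 1#) (+-identityˡ (- 1#)) (+-mono-< 1# 0# (- 1#) 1<0)
    0<[-1]*[-1] : 0# <ℝ 1#
    0<[-1]*[-1] = subst (0# <ℝ_) -1*-1≡1 (*-pos _ _ 0<-1 0<-1)

  0<ιℕ[1+n] : ∀ n → 0# <ℝ ιℕ (suc n)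
  0<ιℕ[1+n] zero    = subst (0# <ℝ_) (sym (+-identityʳ 1#)) 0<1
  0<ιℕ[1+n] (suc n) = <-STO.trans (subst (0# <ℝ_) (sym (+-identityˡ 1#)) 0<1)
                        (subst (0# + 1# <ℝ_) (+-comm _ 1#) (+-mono-< _ _ 1# (0<ιℕ[1+n] n)))

  ιℕ-≢0 : ∀ {n} → ¬ n ≡ 0 → ¬ ιℕ n ≡ 0#
  ιℕ-≢0 {zero}  n≢0 _     = n≢0 refl
  ιℕ-≢0 {suc n} _   ιn≡0 = <-STO.irrefl refl (subst (0# <ℝ_) ιn≡0 (0<ιℕ[1+n] n))

  x*y*y⁻¹≡x : ∀ x {y} → ¬ y ≡ 0# → x * y * y ⁻¹ ≡ x
  x*y*y⁻¹≡x x {y} y≢0 = begin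
    x * y * y ⁻¹       ≡⟨ *-assoc x y (y ⁻¹) ⟩
    x * (y * y ⁻¹)     ≡⟨ cong (x *_) (inverse y y≢0) ⟩
    x * 1#             ≡⟨ *-identityʳ x ⟩
    x                  ∎
    where open ≡-Reasoning

  x*y⁻¹*y≡x : ∀ x {y} → ¬ y ≡ 0# → x * y ⁻¹ * y ≡ x
  x*y⁻¹*y≡x x {y} y≢0 = begin
    x * y ⁻¹ * y       ≡⟨ *-assoc x (y ⁻¹) y ⟩
    x * (y ⁻¹ * y)     ≡⟨ cong (x *_) (trans (*-comm (y ⁻¹) y) (inverse y y≢0)) ⟩
    x * 1#             ≡⟨ *-identityʳ x ⟩
    x                  ∎
    where open ≡-Reasoning

  x*y≡z⇒z*y⁻¹≡x : ∀ {x y z} → ¬ y ≡ 0# → x * y ≡ z → z * y ⁻¹ ≡ x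
  x*y≡z⇒z*y⁻¹≡x {x} y≢0 refl = x*y*y⁻¹≡x x y≢0

  IsInt : ℝ → Set
  IsInt t = ∃ λ (n : ℤ) → t ≡ ι n

  IsInt-ι : ∀ n → IsInt (ι n)
  IsInt-ι n = n , refl

  IsInt-+ : ∀ {s t} → IsInt s → IsInt t → IsInt (s + t)
  IsInt-+ (m , refl) (n , refl) = m ℤ.+ n , sym (ι-+ m n)

  IsInt-neg : ∀ {t} → IsInt t → IsInt (- t)
  IsInt-neg (n , refl) = ℤ.- n , sym (ι-neg n)

  IsInt-* : ∀ {s t} → IsInt s → IsInt t → IsInt (s * t)
  IsInt-* (m , refl) (n , refl) = m ℤ.* n , sym (ι-* m n)

  IsInt-resp : ∀ {s t} → s ≡ t → IsInt s → IsInt t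
  IsInt-resp refl h = h

  IsInt-ι*y⁻¹*y : ∀ a {y} → ¬ y ≡ 0# → IsInt (ι a * y ⁻¹ * y)
  IsInt-ι*y⁻¹*y a y≢0 = IsInt-resp (sym (x*y⁻¹*y≡x (ι a) y≢0)) (IsInt-ι a)

  IsInt-*-∣ : ∀ {t m n} → m ∣ n → IsInt (t * ιℕ m) → IsInt (t * ιℕ n)
  IsInt-*-∣ {t} {m} (divides k refl) tm =
    IsInt-resp (sym (trans (cong (t *_) (ιℕ-* k m)) (*-CS.x∙yz≈y∙xz t (ιℕ k) (ιℕ m))))
               (IsInt-* (IsInt-ι (ℤ.+ k)) tm)

  IsInt-*-Bézout : ∀ {t g a b} x y → g ℕ.+ y ℕ.* b ≡ x ℕ.* a →
                   IsInt (t * ιℕ a) → IsInt (t * ιℕ b) → IsInt (t * ιℕ g)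
  IsInt-*-Bézout {t} {g} {a} {b} x y eq ta tb =
    IsInt-resp (sym t*g≡txa-tyb) (IsInt-+ (multiple x {a} ta) (IsInt-neg (multiple y {b} tb)))
    where
    open ≡-Reasoning
    multiple : ∀ k {c} → IsInt (t * ιℕ c) → IsInt (t * (ιℕ k * ιℕ c))
    multiple k {c} tc = IsInt-resp (*-CS.x∙yz≈y∙xz (ιℕ k) t (ιℕ c)) (IsInt-* (IsInt-ι (ℤ.+ k)) tc)
    g+yb≡xa : ιℕ g + ιℕ y * ιℕ b ≡ ιℕ x * ιℕ a
    g+yb≡xa = begin
      ιℕ g + ιℕ y * ιℕ b         ≡⟨ cong (ιℕ g +_) (ιℕ-* y b) ⟨
      ιℕ g + ιℕ (y ℕ.* b)        ≡⟨ ιℕ-+ g (y ℕ.* b) ⟨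
      ιℕ (g ℕ.+ y ℕ.* b)         ≡⟨ cong ιℕ eq ⟩
      ιℕ (x ℕ.* a)               ≡⟨ ιℕ-* x a ⟩
      ιℕ x * ιℕ a                ∎
    t*g≡txa-tyb : t * ιℕ g ≡ t * (ιℕ x * ιℕ a) - t * (ιℕ y * ιℕ b)
    t*g≡txa-tyb = trans (cong (t *_) (x≈z//y _ _ _ g+yb≡xa)) (x[y-z]≈xy-xz t _ _)

  IsInt-*-gcd : ∀ {t} m n → IsInt (t * ιℕ m) → IsInt (t * ιℕ n) → IsInt (t * ιℕ (gcd m n))
  IsInt-*-gcd m n tm tn with Bézout.identity (gcd-GCD m n)
  ... | Bézout.+- x y eq = IsInt-*-Bézout x y eq tm tn
  ... | Bézout.-+ x y eq = IsInt-*-Bézout y x eq tn tm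

module Lattice (ℝs : Reals) (ℓ : ℕ) where
  open Reals ℝs using (ℝ)
  open Scalars ℝs {ℓ}
  open Torus ℝs {ℓ} using (ι; ιℕ; Vecℝ; _∼_; act; InTγ; InTq)
  open import Function.Construct.Composition using (_⇔-∘_)

  ∑ℝ : ∀ {n} → (Fin n → ℝ) → ℝ
  ∑ℝ = ∑ _+_ 0#

  ∑ℝ-cong : ∀ {n} {f g : Fin n → ℝ} → (∀ i → f i ≡ g i) → ∑ℝ f ≡ ∑ℝ g
  ∑ℝ-cong {zero}  f≗g = refl
  ∑ℝ-cong {suc n} f≗g = cong₂ _+_ (f≗g zero) (∑ℝ-cong (λ i → f≗g (suc i)))

  ∑ℝ-0 : ∀ n → ∑ℝ {n} (λ _ → 0#) ≡ 0#
  ∑ℝ-0 zero    = refl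
  ∑ℝ-0 (suc n) = trans (cong (0# +_) (∑ℝ-0 n)) (+-identityˡ 0#)

  ∑ℝ-+ : ∀ {n} (f g : Fin n → ℝ) → ∑ℝ (λ i → f i + g i) ≡ ∑ℝ f + ∑ℝ g
  ∑ℝ-+ {zero}  f g = sym (+-identityˡ 0#)
  ∑ℝ-+ {suc n} f g =
    trans (cong (f zero + g zero +_) (∑ℝ-+ (λ i → f (suc i)) (λ i → g (suc i)))) (+-CS.interchange _ _ _ _)

  ∑ℝ-*ˡ : ∀ {n} c (f : Fin n → ℝ) → ∑ℝ (λ i → c * f i) ≡ c * ∑ℝ f
  ∑ℝ-*ˡ {zero}  c f = sym (zeroʳ c)
  ∑ℝ-*ˡ {suc n} c f = trans (cong (c * f zero +_) (∑ℝ-*ˡ c (λ i → f (suc i)))) (sym (distribˡ c _ _))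

  ∑ℝ-comm : ∀ {m n} (f : Fin m → Fin n → ℝ) → ∑ℝ (λ i → ∑ℝ (f i)) ≡ ∑ℝ (λ k → ∑ℝ (λ i → f i k))
  ∑ℝ-comm {zero}  {n} f = sym (∑ℝ-0 n)
  ∑ℝ-comm {suc m} {n} f =
    trans (cong (∑ℝ (f zero) +_) (∑ℝ-comm (λ i → f (suc i)))) (sym (∑ℝ-+ (f zero) _))

  ∑ℝ-single : ∀ {n} (f : Fin n → ℝ) j → (∀ i → i ≢ j → f i ≡ 0#) → ∑ℝ f ≡ f j
  ∑ℝ-single {suc n} f zero    off =
    trans (cong (f zero +_) (trans (∑ℝ-cong (λ i → off (suc i) λ ())) (∑ℝ-0 n))) (+-identityʳ _)
  ∑ℝ-single {suc n} f (suc j) off =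
    trans (cong (_+ ∑ℝ (λ i → f (suc i))) (off zero λ ()))
          (trans (+-identityˡ _)
                 (∑ℝ-single (λ i → f (suc i)) j (λ i i≢j → off (suc i) (i≢j ∘ Finₚ.suc-injective))))

  ∑ℝ-*ʳ : ∀ {n} c (f : Fin n → ℝ) → ∑ℝ (λ i → f i * c) ≡ ∑ℝ f * c
  ∑ℝ-*ʳ c f = trans (∑ℝ-cong (λ i → *-comm (f i) c)) (trans (∑ℝ-*ˡ c f) (*-comm c _))

  ∑ℝ-neg : ∀ {n} (f : Fin n → ℝ) → ∑ℝ (λ i → - f i) ≡ - ∑ℝ f
  ∑ℝ-neg f = trans (∑ℝ-cong (λ i → sym (-1*x≈-x (f i)))) (trans (∑ℝ-*ˡ (- 1#) f) (-1*x≈-x _))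

  act-cong : ∀ (M : Mat ℓ) {x y : Vecℝ} → (∀ i → x i ≡ y i) → ∀ j → act M x j ≡ act M y j
  act-cong M x≗y j = ∑ℝ-cong (λ i → cong (_* ι (M i j)) (x≗y i))

  act-congˡ : ∀ {M N : Mat ℓ} → M ≋ N → ∀ x j → act M x j ≡ act N x j
  act-congˡ M≋N x j = ∑ℝ-cong (λ i → cong (λ m → x i * ι m) (M≋N i j))

  act-+ : ∀ (M : Mat ℓ) (x y : Vecℝ) j → act M (λ i → x i + y i) j ≡ act M x j + act M y j
  act-+ M x y j = trans (∑ℝ-cong (λ i → distribʳ (ι (M i j)) (x i) (y i)))
                        (∑ℝ-+ (λ i → x i * ι (M i j)) (λ i → y i * ι (M i j)))

  act-*ˡ : ∀ (M : Mat ℓ) c (x : Vecℝ) j → act M (λ i → c * x i) j ≡ c * act M x j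
  act-*ˡ M c x j =
    trans (∑ℝ-cong (λ i → *-assoc c (x i) (ι (M i j)))) (∑ℝ-*ˡ c (λ i → x i * ι (M i j)))

  actℤ : Mat ℓ → (Fin ℓ → ℤ) → Fin ℓ → ℤ
  actℤ M z j = ∑ ℤ._+_ (ℤ.+ 0) (λ i → z i ℤ.* M i j)

  act-ι : ∀ (M : Mat ℓ) (z : Fin ℓ → ℤ) j → act M (λ i → ι (z i)) j ≡ ι (actℤ M z j)
  act-ι M z j = sym (trans (ι-∑ (λ i → z i ℤ.* M i j)) (∑ℝ-cong (λ i → ι-* (z i) (M i j))))

  act-⊗ : ∀ (A B : Mat ℓ) (x : Vecℝ) j → act B (act A x) j ≡ act (A ⊗ B) x j
  act-⊗ A B x j = begin
    ∑ℝ (λ k → act A x k * ι (B k j))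
      ≡⟨ ∑ℝ-cong (λ k → sym (∑ℝ-*ʳ (ι (B k j)) (λ i → x i * ι (A i k)))) ⟩
    ∑ℝ (λ k → ∑ℝ (λ i → x i * ι (A i k) * ι (B k j)))
      ≡⟨ ∑ℝ-comm (λ k i → x i * ι (A i k) * ι (B k j)) ⟩
    ∑ℝ (λ i → ∑ℝ (λ k → x i * ι (A i k) * ι (B k j)))
      ≡⟨ ∑ℝ-cong (λ i → ∑ℝ-cong (λ k → *-assoc (x i) (ι (A i k)) (ι (B k j)))) ⟩
    ∑ℝ (λ i → ∑ℝ (λ k → x i * (ι (A i k) * ι (B k j))))
      ≡⟨ ∑ℝ-cong (λ i → ∑ℝ-*ˡ (x i) (λ k → ι (A i k) * ι (B k j))) ⟩
    ∑ℝ (λ i → x i * ∑ℝ (λ k → ι (A i k) * ι (B k j)))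
      ≡⟨ ∑ℝ-cong (λ i → cong (x i *_) entry) ⟩
    act (A ⊗ B) x j
      ∎
    where
    open ≡-Reasoning
    entry : ∀ {i} → ∑ℝ (λ k → ι (A i k) * ι (B k j)) ≡ ι ((A ⊗ B) i j)
    entry {i} = sym (trans (ι-∑ (λ k → A i k ℤ.* B k j)) (∑ℝ-cong (λ k → ι-* (A i k) (B k j))))

  act-diagonal : ∀ (M : Mat ℓ) (x : Vecℝ) j → (∀ i → i ≢ j → M i j ≡ ℤ.+ 0) →
                 act M x j ≡ x j * ι (M j j)
  act-diagonal M x j off =
    ∑ℝ-single _ j (λ i i≢j → trans (cong (λ m → x i * ι m) (off i i≢j)) (zeroʳ (x i)))

  I-diagonal : ∀ (j : Fin ℓ) → I j j ≡ ℤ.+ 1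
  I-diagonal j with toℕ j ℕ.≟ toℕ j
  ... | yes _ = refl
  ... | no ¬refl = ⊥-elim (¬refl refl)

  I-offDiagonal : ∀ (i j : Fin ℓ) → i ≢ j → I i j ≡ ℤ.+ 0
  I-offDiagonal i j i≢j with toℕ i ℕ.≟ toℕ j
  ... | yes i≡j = ⊥-elim (i≢j (Finₚ.toℕ-injective i≡j))
  ... | no _    = refl

  act-I : ∀ (x : Vecℝ) j → act I x j ≡ x j
  act-I x j = begin
    act I x j           ≡⟨ act-diagonal I x j (λ i → I-offDiagonal i j) ⟩
    x j * ι (I j j)     ≡⟨ cong (λ m → x j * ι m) (I-diagonal j) ⟩
    x j * (1# + 0#)     ≡⟨ cong (x j *_) (+-identityʳ 1#) ⟩
    x j * 1#            ≡⟨ *-identityʳ (x j) ⟩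
    x j                 ∎
    where open ≡-Reasoning

  act-⊖ : ∀ (A B : Mat ℓ) (x : Vecℝ) j → act (A ⊖ B) x j ≡ act A x j - act B x j
  act-⊖ A B x j = begin
    ∑ℝ (λ i → x i * ι (A i j ℤ.- B i j))
      ≡⟨ ∑ℝ-cong (λ i → cong (x i *_) (entry i)) ⟩
    ∑ℝ (λ i → x i * (ι (A i j) - ι (B i j)))
      ≡⟨ ∑ℝ-cong (λ i → x[y-z]≈xy-xz (x i) (ι (A i j)) (ι (B i j))) ⟩
    ∑ℝ (λ i → x i * ι (A i j) - x i * ι (B i j))
      ≡⟨ ∑ℝ-+ (λ i → x i * ι (A i j)) (λ i → - (x i * ι (B i j))) ⟩
    act A x j + ∑ℝ (λ i → - (x i * ι (B i j)))
      ≡⟨ cong (act A x j +_) (∑ℝ-neg (λ i → x i * ι (B i j))) ⟩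
    act A x j - act B x j
      ∎
    where
    open ≡-Reasoning
    entry : ∀ i → ι (A i j ℤ.- B i j) ≡ ι (A i j) - ι (B i j)
    entry i = trans (ι-+ (A i j) (ℤ.- B i j)) (cong (ι (A i j) +_) (ι-neg (B i j)))

  act-inverse : ∀ (A B : Mat ℓ) → (A ⊗ B) ≋ I → ∀ x j → act B (act A x) j ≡ x j
  act-inverse A B AB≋I x j = trans (act-⊗ A B x j) (trans (act-congˡ AB≋I x j) (act-I x j))

  IntV : Vecℝ → Set
  IntV y = ∀ j → IsInt (y j)

  IntV-≗ : ∀ {x y : Vecℝ} → (∀ j → x j ≡ y j) → IntV x ⇔ IntV y
  IntV-≗ x≗y = mk⇔ (λ h j → IsInt-resp (x≗y j) (h j)) (λ h j → IsInt-resp (sym (x≗y j)) (h j))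

  IntV-act : ∀ (M : Mat ℓ) {y} → IntV y → IntV (act M y)
  IntV-act M {y} int j =
    IsInt-resp (sym (trans (act-cong M (λ i → proj₂ (int i)) j) (act-ι M (λ i → proj₁ (int i)) j)))
               (IsInt-ι (actℤ M (λ i → proj₁ (int i)) j))

  IntV⇔IntV-act : ∀ {A} → Unimodular A → ∀ y → IntV y ⇔ IntV (act A y)
  IntV⇔IntV-act {A} (B , AB≋I , _) y =
    mk⇔ (IntV-act A) (λ h → Equivalence.to (IntV-≗ (act-inverse A B AB≋I y)) (IntV-act B h))

  ≡⇒∼ : ∀ {x y} → (∀ j → x j ≡ y j) → x ∼ y
  ≡⇒∼ x≗y = (λ _ → ℤ.+ 0) , λ j → trans (x≗y j) (sym (+-identityʳ _))

  ∼-sym : ∀ {x y} → x ∼ y → y ∼ x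
  ∼-sym {x} {y} (z , x≡y+z) = (λ j → ℤ.- z j) , λ j →
    trans (x≈z//y (y j) (ι (z j)) (x j) (sym (x≡y+z j))) (cong (x j +_) (sym (ι-neg (z j))))

  ∼-trans : ∀ {x y w} → x ∼ y → y ∼ w → x ∼ w
  ∼-trans {x} {y} {w} (z , x≡y+z) (z′ , y≡w+z′) = (λ j → z′ j ℤ.+ z j) , λ j → begin
    x j                          ≡⟨ x≡y+z j ⟩
    y j + ι (z j)                ≡⟨ cong (_+ ι (z j)) (y≡w+z′ j) ⟩
    w j + ι (z′ j) + ι (z j)     ≡⟨ +-assoc (w j) _ _ ⟩
    w j + (ι (z′ j) + ι (z j))   ≡⟨ cong (w j +_) (ι-+ (z′ j) (z j)) ⟨
    w j + ι (z′ j ℤ.+ z j)       ∎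
    where open ≡-Reasoning

  ∼-act : ∀ (M : Mat ℓ) {x y} → x ∼ y → act M x ∼ act M y
  ∼-act M {x} {y} (z , x≡y+z) = actℤ M z , λ j → begin
    act M x j                                   ≡⟨ act-cong M x≡y+z j ⟩
    act M (λ i → y i + ι (z i)) j               ≡⟨ act-+ M y _ j ⟩
    act M y j + act M (λ i → ι (z i)) j         ≡⟨ cong (act M y j +_) (act-ι M z j) ⟩
    act M y j + ι (actℤ M z j)                  ∎
    where open ≡-Reasoning

  ∼-*ˡ : ∀ n {x y} → x ∼ y → (λ j → ιℕ n * x j) ∼ (λ j → ιℕ n * y j)
  ∼-*ˡ n {x} {y} (z , x≡y+z) = (λ j → ℤ.+ n ℤ.* z j) , λ j →
    trans (cong (ιℕ n *_) (x≡y+z j))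
          (trans (distribˡ (ιℕ n) (y j) _) (cong (ιℕ n * y j +_) (sym (ι-* (ℤ.+ n) (z j)))))

  ∼⇔IntV-− : ∀ {x y} → x ∼ y ⇔ IntV (λ j → x j - y j)
  ∼⇔IntV-− = mk⇔ (λ (z , x≡y+z) j → z j , x≡y+z⇒x-y≡z (x≡y+z j))
                 (λ h → (λ j → proj₁ (h j)) , λ j → x-y≡z⇒x≡y+z (proj₂ (h j)))

  InTγ-resp-∼ : ∀ (M : Mat ℓ) {x y} → x ∼ y → InTγ M y → InTγ M x
  InTγ-resp-∼ M x∼y y-fixed = ∼-trans (∼-act M x∼y) (∼-trans y-fixed (∼-sym x∼y))

  InTq-resp-∼ : ∀ q {x y} → x ∼ y → InTq q y → InTq q x
  InTq-resp-∼ q x∼y y-torsion = ∼-trans (∼-*ˡ q x∼y) y-torsion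

  InTγ⇔IntV : ∀ (M : Mat ℓ) x → InTγ M x ⇔ IntV (act (M ⊖ I) x)
  InTγ⇔IntV M x = IntV-≗ (λ j → sym (act-⊖-I j)) ⇔-∘ ∼⇔IntV-−
    where
    act-⊖-I : ∀ j → act (M ⊖ I) x j ≡ act M x j - x j
    act-⊖-I j = trans (act-⊖ M I x j) (cong (λ t → act M x j - t) (act-I x j))

  InTq⇔IntV : ∀ q x → InTq q x ⇔ IntV (λ j → ιℕ q * x j)
  InTq⇔IntV q x = mk⇔ (λ (z , qx≡0+z) j → z j , trans (qx≡0+z j) (+-identityˡ _))
                      (λ h → (λ j → proj₁ (h j)) , λ j → trans (proj₂ (h j)) (sym (+-identityˡ _)))

module Prefix (ℝs : Reals) {ℓ r : ℕ} (r≤ℓ : r ℕ.≤ ℓ) where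
  open Reals ℝs using (ℝ)
  open Scalars ℝs {ℓ}
  open Lattice ℝs ℓ
  open Torus ℝs {ℓ} using (ι; ιℕ; Vecℝ; act; split)

  inj : Fin r → Fin ℓ
  inj i = inject≤ i r≤ℓ

  toℕ-inj<r : ∀ i → toℕ (inj i) ℕ.< r
  toℕ-inj<r i = subst (ℕ._< r) (sym (Finₚ.toℕ-inject≤ i r≤ℓ)) (Finₚ.toℕ<n i)

  fromℕ<-inj : ∀ i (p : toℕ (inj i) ℕ.< r) → fromℕ< p ≡ i
  fromℕ<-inj i p = Finₚ.toℕ-injective (trans (Finₚ.toℕ-fromℕ< p) (Finₚ.toℕ-inject≤ i r≤ℓ))

  data Position : Fin ℓ → Set where
    inside  : ∀ i → Position (inj i)
    outside : ∀ {j} → ¬ toℕ j ℕ.< r → Position j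

  position : ∀ j → Position j
  position j with toℕ j ℕ.<? r
  ... | yes j<r = subst Position inj-fromℕ< (inside (fromℕ< j<r))
    where
    inj-fromℕ< : inj (fromℕ< j<r) ≡ j
    inj-fromℕ< = Finₚ.toℕ-injective (trans (Finₚ.toℕ-inject≤ _ r≤ℓ) (Finₚ.toℕ-fromℕ< j<r))
  ... | no j≮r  = outside j≮r

  split-inside : ∀ (f : Fin r → ℝ) g i → split r f g (inj i) ≡ f i
  split-inside f g i with toℕ (inj i) ℕ.<? r
  ... | yes p = cong f (fromℕ<-inj i p)
  ... | no ¬p = ⊥-elim (¬p (toℕ-inj<r i))

  split-outside : ∀ (f : Fin r → ℝ) g {j} → ¬ toℕ j ℕ.< r → split r f g j ≡ g j
  split-outside f g {j} j≮r with toℕ j ℕ.<? r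
  ... | yes j<r = ⊥-elim (j≮r j<r)
  ... | no _    = refl

  split-≗ : ∀ {f : Fin r → ℝ} {g h : Vecℝ} → (∀ i → f i ≡ h (inj i)) → (∀ j → g j ≡ h j) →
            ∀ j → split r f g j ≡ h j
  split-≗ {f} {g} f≗h g≗h j with position j
  ... | inside i    = trans (split-inside f g i) (f≗h i)
  ... | outside j≮r = trans (split-outside f g j≮r) (g≗h j)

  diag-offDiagonal : ∀ d (i j : Fin ℓ) → i ≢ j → diag {ℓ} r d i j ≡ ℤ.+ 0
  diag-offDiagonal d i j i≢j with toℕ i ℕ.≟ toℕ j
  ... | yes i≡j = ⊥-elim (i≢j (Finₚ.toℕ-injective i≡j))
  ... | no _    = refl

  diag-inside : ∀ d i → diag {ℓ} r d (inj i) (inj i) ≡ ℤ.+ d i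
  diag-inside d i with toℕ (inj i) ℕ.≟ toℕ (inj i) | toℕ (inj i) ℕ.<? r
  ... | yes _    | yes p = cong (λ k → ℤ.+ d k) (fromℕ<-inj i p)
  ... | yes _    | no ¬p = ⊥-elim (¬p (toℕ-inj<r i))
  ... | no ¬refl | _     = ⊥-elim (¬refl refl)

  diag-outside : ∀ d {j : Fin ℓ} → ¬ toℕ j ℕ.< r → diag {ℓ} r d j j ≡ ℤ.+ 0
  diag-outside d {j} j≮r with toℕ j ℕ.≟ toℕ j | toℕ j ℕ.<? r
  ... | yes _    | yes j<r = ⊥-elim (j≮r j<r)
  ... | yes _    | no _    = refl
  ... | no ¬refl | _       = ⊥-elim (¬refl refl)

  IntV-diag⇔ : ∀ d s → IntV (act (diag r d) s) ⇔ (∀ i → IsInt (s (inj i) * ιℕ (d i)))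
  IntV-diag⇔ d s = mk⇔ (λ h i → IsInt-resp (act-diag-inside i) (h (inj i))) from
    where
    act-diag : ∀ j → act (diag r d) s j ≡ s j * ι (diag r d j j)
    act-diag j = act-diagonal (diag r d) s j (λ i → diag-offDiagonal d i j)
    act-diag-inside : ∀ i → act (diag r d) s (inj i) ≡ s (inj i) * ιℕ (d i)
    act-diag-inside i = trans (act-diag (inj i)) (cong (λ m → s (inj i) * ι m) (diag-inside d i))
    from : (∀ i → IsInt (s (inj i) * ιℕ (d i))) → IntV (act (diag r d) s)
    from h j with position j
    ... | inside i    = IsInt-resp (sym (act-diag-inside i)) (h i)
    ... | outside j≮r =
      ℤ.+ 0 , trans (act-diag j) (trans (cong (λ m → s j * ι m) (diag-outside d j≮r)) (zeroʳ (s j)))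

module SmithCoordinates (ℝs : Reals) {ℓ r : ℕ} {R U V : Mat ℓ} {d : Fin r → ℕ}
  (r≤ℓ : r ℕ.≤ ℓ) (d>0 : ∀ i → 0 ℕ.< d i)
  (U-unimodular : Unimodular U) (V-unimodular : Unimodular V)
  (smith : ((U ⊗ (R ⊖ I)) ⊗ V) ≋ diag r d) where
  open Reals ℝs using (_⁻¹)
  open Scalars ℝs {ℓ}
  open Lattice ℝs ℓ
  open Prefix ℝs r≤ℓ
  open Torus ℝs {ℓ}
    using (ι; ιℕ; Vecℝ; _∼_; act; split; InTγ; InTq; InRHS₁; InRHS₂)
  module ⇔-Reasoning = SetoidReasoning (⇔-setoid 0ℓ)

  U⁻¹ : Mat ℓ
  U⁻¹ = proj₁ U-unimodular

  -- x = ∑ᵢ cᵢ uᵢ = act U c for c = coordinates x.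
  coordinates : Vecℝ → Vecℝ
  coordinates = act U⁻¹

  comb-coordinates : ∀ x → act U (coordinates x) ∼ x
  comb-coordinates x = ≡⇒∼ (act-inverse U⁻¹ U (proj₂ (proj₂ U-unimodular)) x)

  ∼-comb : ∀ {x s} → (∀ j → s j ≡ coordinates x j) → x ∼ act U s
  ∼-comb {x} s≗c = ∼-sym (∼-trans (≡⇒∼ (act-cong U s≗c)) (comb-coordinates x))

  FixedCoords : Vecℝ → Set
  FixedCoords s = ∀ i → IsInt (s (inj i) * ιℕ (d i))

  TorsionCoords : ℕ → Vecℝ → Set
  TorsionCoords q s = ∀ j → IsInt (s j * ιℕ q)

  smith-act : ∀ s j → act V (act (R ⊖ I) (act U s)) j ≡ act (diag r d) s j
  smith-act s j = begin
    act V (act (R ⊖ I) (act U s)) j      ≡⟨ act-cong V (act-⊗ U (R ⊖ I) s) j ⟩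
    act V (act (U ⊗ (R ⊖ I)) s) j        ≡⟨ act-⊗ (U ⊗ (R ⊖ I)) V s j ⟩
    act ((U ⊗ (R ⊖ I)) ⊗ V) s j          ≡⟨ act-congˡ smith s j ⟩
    act (diag r d) s j                   ∎
    where open ≡-Reasoning

  InTγ⇔FixedCoords : ∀ s → InTγ R (act U s) ⇔ FixedCoords s
  InTγ⇔FixedCoords s = begin
    InTγ R (act U s)                      ≈⟨ InTγ⇔IntV R (act U s) ⟩
    IntV (act (R ⊖ I) (act U s))          ≈⟨ IntV⇔IntV-act V-unimodular _ ⟩
    IntV (act V (act (R ⊖ I) (act U s)))  ≈⟨ IntV-≗ (smith-act s) ⟩
    IntV (act (diag r d) s)               ≈⟨ IntV-diag⇔ d s ⟩
    FixedCoords s                         ∎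
    where open ⇔-Reasoning

  InTq⇔TorsionCoords : ∀ q s → InTq q (act U s) ⇔ TorsionCoords q s
  InTq⇔TorsionCoords q s = begin
    InTq q (act U s)                      ≈⟨ InTq⇔IntV q (act U s) ⟩
    IntV (λ j → ιℕ q * act U s j)         ≈⟨ IntV-≗ (λ j → sym (act-*ˡ U (ιℕ q) s j)) ⟩
    IntV (act U (λ j → ιℕ q * s j))       ≈⟨ IntV⇔IntV-act U-unimodular _ ⟨
    IntV (λ j → ιℕ q * s j)               ≈⟨ IntV-≗ (λ j → *-comm (ιℕ q) (s j)) ⟩
    TorsionCoords q s                     ∎
    where open ⇔-Reasoning

  InTγ⇒FixedCoords : ∀ {x} → InTγ R x → FixedCoords (coordinates x)
  InTγ⇒FixedCoords {x} = Equivalence.to (InTγ⇔FixedCoords _) ∘ InTγ-resp-∼ R (comb-coordinates x)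

  InTq⇒TorsionCoords : ∀ {q x} → InTq q x → TorsionCoords q (coordinates x)
  InTq⇒TorsionCoords {q} {x} = Equivalence.to (InTq⇔TorsionCoords q _) ∘ InTq-resp-∼ q (comb-coordinates x)

  FixedCoords⇒InTγ : ∀ {x s} → x ∼ act U s → FixedCoords s → InTγ R x
  FixedCoords⇒InTγ x∼Us = InTγ-resp-∼ R x∼Us ∘ Equivalence.from (InTγ⇔FixedCoords _)

  TorsionCoords⇒InTq : ∀ {q x s} → x ∼ act U s → TorsionCoords q s → InTq q x
  TorsionCoords⇒InTq {q} x∼Us = InTq-resp-∼ q x∼Us ∘ Equivalence.from (InTq⇔TorsionCoords q _)

  InTγ⇔InRHS₁ : ∀ x → InTγ R x ⇔ InRHS₁ U r d x
  InTγ⇔InRHS₁ x = mk⇔ to from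
    where
    ιd≢0 : ∀ i → ¬ ιℕ (d i) ≡ 0#
    ιd≢0 i = ιℕ-≢0 (ℕₚ.n>0⇒n≢0 (d>0 i))
    to : InTγ R x → InRHS₁ U r d x
    to x-fixed = a , coordinates x , ∼-comb (split-≗ a/d≡c (λ _ → refl))
      where
      fixed : FixedCoords (coordinates x)
      fixed = InTγ⇒FixedCoords x-fixed
      a : Fin r → ℤ
      a i = proj₁ (fixed i)
      a/d≡c : ∀ i → ι (a i) * ιℕ (d i) ⁻¹ ≡ coordinates x (inj i)
      a/d≡c i = x*y≡z⇒z*y⁻¹≡x (ιd≢0 i) (proj₂ (fixed i))
    from : InRHS₁ U r d x → InTγ R x
    from (a , b , x∼Us) = FixedCoords⇒InTγ x∼Us λ i →
      IsInt-resp (cong (_* ιℕ (d i)) (sym (split-inside _ b i))) (IsInt-ι*y⁻¹*y (a i) (ιd≢0 i))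

  InTq×InTγ⇔InRHS₂ : ∀ q → 0 ℕ.< q → ∀ x → (InTq q x × InTγ R x) ⇔ InRHS₂ U r d q x
  InTq×InTγ⇔InRHS₂ q q>0 x = mk⇔ to from
    where
    g : Fin r → ℕ
    g i = gcd (d i) q
    ιq≢0 : ¬ ιℕ q ≡ 0#
    ιq≢0 = ιℕ-≢0 (ℕₚ.n>0⇒n≢0 q>0)
    ιg≢0 : ∀ i → ¬ ιℕ (g i) ≡ 0#
    ιg≢0 i = ιℕ-≢0 (gcd[m,n]≢0 (d i) q (inj₂ (ℕₚ.n>0⇒n≢0 q>0)))
    to : InTq q x × InTγ R x → InRHS₂ U r d q x
    to (x-torsion , x-fixed) = a , b , ∼-comb (split-≗ a/g≡c b/q≡c)
      where
      c : Vecℝ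
      c = coordinates x
      torsion : TorsionCoords q c
      torsion = InTq⇒TorsionCoords {q} x-torsion
      gcd-integral : ∀ i → IsInt (c (inj i) * ιℕ (g i))
      gcd-integral i = IsInt-*-gcd (d i) q (InTγ⇒FixedCoords x-fixed i) (torsion (inj i))
      a : Fin r → ℤ
      a i = proj₁ (gcd-integral i)
      b : Fin ℓ → ℤ
      b j = proj₁ (torsion j)
      a/g≡c : ∀ i → ι (a i) * ιℕ (g i) ⁻¹ ≡ c (inj i)
      a/g≡c i = x*y≡z⇒z*y⁻¹≡x (ιg≢0 i) (proj₂ (gcd-integral i))
      b/q≡c : ∀ j → ι (b j) * ιℕ q ⁻¹ ≡ c j
      b/q≡c j = x*y≡z⇒z*y⁻¹≡x ιq≢0 (proj₂ (torsion j))
    from : InRHS₂ U r d q x → InTq q x × InTγ R x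
    from (a , b , x∼Us) = TorsionCoords⇒InTq {q} x∼Us torsion , FixedCoords⇒InTγ x∼Us fixed
      where
      s : Vecℝ
      s = split r (λ i → ι (a i) * ιℕ (g i) ⁻¹) (λ j → ι (b j) * ιℕ q ⁻¹)
      gcd-integral : ∀ i → IsInt (s (inj i) * ιℕ (g i))
      gcd-integral i =
        IsInt-resp (cong (_* ιℕ (g i)) (sym (split-inside _ _ i))) (IsInt-ι*y⁻¹*y (a i) (ιg≢0 i))
      fixed : FixedCoords s
      fixed i = IsInt-*-∣ (gcd[m,n]∣m (d i) q) (gcd-integral i)
      torsion : TorsionCoords q s
      torsion j with position j
      ... | inside i    = IsInt-*-∣ (gcd[m,n]∣n (d i) q) (gcd-integral i)
      ... | outside j≮r =
        IsInt-resp (cong (_* ιℕ q) (sym (split-outside _ _ j≮r))) (IsInt-ι*y⁻¹*y (b j) ιq≢0)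

mainTheorem16 :
    (ℝs : Reals) (ℓ : ℕ) (Γ : Group 0ℓ 0ℓ) → Finite Γ → (ρ : FaithfulRep Γ ℓ) →
    (γ : Group.Carrier Γ) →
    (r : ℕ) (d : Fin r → ℕ) (U V : Mat ℓ) →
    IsSmithForm (FaithfulRep.R ρ γ) r d U V →
    let open Torus ℝs {ℓ} in
      (∀ (x : Vecℝ) → InTγ (FaithfulRep.R ρ γ) x ⇔ InRHS₁ U r d x) ×
      (∀ (q : ℕ) → 0 < q → ∀ (x : Vecℝ) →
         (InTq q x × InTγ (FaithfulRep.R ρ γ) x) ⇔ InRHS₂ U r d q x)
mainTheorem16 ℝs ℓ Γ _ ρ γ r d U V (r≤ℓ , d>0 , _ , U-unimodular , V-unimodular , smith) =
  InTγ⇔InRHS₁ , InTq×InTγ⇔InRHS₂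
  where open SmithCoordinates ℝs {R = FaithfulRep.R ρ γ} r≤ℓ d>0 U-unimodular V-unimodular smith
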